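{- Let $(H_n)_{n\ge1}$ be defined recursively by $H_1=1$ and $H_n=\sum_{d\mid n,\,d<n}H_d$ for $n>1$. Then $0<H_n\le n^2$ for every $n\ge1$. In addition, if $(b_n)_{n\ge1}$ is any sequence (of complex numbers) and $(a_n)_{n\ge1}$ is defined by $a_n=\sum_{d\mid n}b_dH_{n/d}$, then $b_n=a_n-\sum_{d\mid n,\,d<n}a_d$ for every $n\ge1$. -}

module Defs where

open import Level using (Level)
open import Data.Nat using (ℕ; suc; _∸_)
open import Data.Nat.DivMod using (_/_)
open import Data.Nat.Divisibility using (_∣?_)
open import Data.List using (List; filter; map; applyUpTo; upTo; foldr)
open import Data.Nat.ListAction using (sum)
open import Algebra.Bundles using (CommutativeRing)
import Algebra.Definitions.RawMonoid as RawMonoidDefs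

properDivisors : ℕ → List ℕ
properDivisors n = filter (_∣? n) (applyUpTo suc (n ∸ 1))

properDivisorSumℕ : (ℕ → ℕ) → ℕ → ℕ
properDivisorSumℕ f n = sum (map f (properDivisors n))

module RingSums {c ℓ : Level} (R : CommutativeRing c ℓ) where
  open CommutativeRing R public
  open RawMonoidDefs +-rawMonoid using (_×_)

  fromℕ : ℕ → Carrier
  fromℕ k = k × 1#

  ΣR : List Carrier → Carrier
  ΣR = foldr _+_ 0#

  -- Σ_{d ∣ n} f d (n / d), d ranging over 1 ≤ d ≤ n  (d = suc k)
  divisorSumWithQuot : ℕ → (ℕ → ℕ → Carrier) → Carrier
  divisorSumWithQuot n f =
    ΣR (map (λ k → f (suc k) (n / suc k)) (filter (λ k → suc k ∣? n) (upTo n)))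

  properDivisorSum : ℕ → (ℕ → Carrier) → Carrier
  properDivisorSum n f = ΣR (map f (properDivisors n))

module Submission where

-- Besides the usual algebra of such sums (congruence, Fubini, splitting off the last
-- term), the central tool is a reindexing lemma Σ-reindex: a sum is unchanged when its support is
-- traversed along an injective map.  It yields two divisor-sum identities:
--   * Σ-multiples: for n = q·e, summing g (d / e) over the proper divisors d of n that are
--     multiples of e is summing g m over the proper divisors m of q;
--   * proper-divisor-squares: Σ_{d ∣ n, d < n} d² = Σ_{k ∣ n, k ≥ 2} (n/k)² ≤ n², the last
--     step by comparing with the telescoping differences n²/(k−1) − n²/k.
-- For H (module HSequence): positivity because the summand H 1 = 1 always occurs, the bound
-- H n ≤ n² by strong induction and proper-divisor-squares, and the key identity H-multiples,
-- Σ_{d ∣ n, d < n, e ∣ d} H (d / e) = [e ∣ n] H (n / e) for e < n, from Σ-multiples.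
-- For the inversion (module Inversion), a d and Σ_{d ∣ n, d < n} a d are written as linear
-- combinations of b 1, ..., b n with coefficients in ℕ; by H-multiples the coefficients agree
-- except for that of b n, which is H 1 = 1 in a n and 0 in the divisor sum.

open import Defs
open import Level using (Level)
open import Data.Nat using (ℕ; _≤_; _<_) renaming (_*_ to _*ℕ_)
open import Data.Product using (_×_)
open import Relation.Binary.PropositionalEquality using (_≡_)
open import Algebra.Bundles using (CommutativeRing)
open import Data.Nat using (zero; suc; pred; _∸_; NonZero; _≟_; z≤n; s≤s; z<s; s<s; >-nonZero)
open import Data.Nat.Properties using (0≢1+n; 1+n≢0; suc-injective; suc-pred; ≤-trans; m≤m*n; *-monoˡ-<; *-cancelʳ-<; *-cancelʳ-≡)
open import Data.Nat.Divisibility using (_∣_; _∣?_; divides; ∣-trans; n∣m*n; *-monoˡ-∣; *-cancelʳ-∣)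
open import Data.Nat.DivMod using (_/_; m*n/n≡m)
open import Data.Bool using (true; false; if_then_else_)
open import Data.List using (map; filter; applyUpTo; foldr)
open import Data.Product using (_,_; proj₁; proj₂; ∃-syntax)
open import Data.Empty using (⊥)
open import Data.Sum using (_⊎_; inj₁; inj₂)
open import Relation.Nullary using (¬_; Dec; yes; no; does; contradiction)
open import Relation.Nullary.Decidable using (_×-dec_)
open import Relation.Unary using (Decidable)
import Relation.Binary.PropositionalEquality as ≡
open import Algebra.Bundles using (CommutativeMonoid)
import Algebra.Properties.CommutativeSemigroup as CommutativeSemigroupProperties

<⇒≤∸1 : ∀ {d n} → d < n → d ≤ n ∸ 1
<⇒≤∸1 {n = suc _} (s≤s d≤n) = d≤n

≤∸1⇒< : ∀ {d n} → 1 ≤ d → d ≤ n ∸ 1 → d < n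
≤∸1⇒< {n = zero} 1≤d d≤0 = contradiction (≤-trans 1≤d d≤0) λ ()
≤∸1⇒< {n = suc _} _ d≤n = s≤s d≤n

module Sums {c ℓ} (M : CommutativeMonoid c ℓ) where
  open import Data.Nat using (_*_)
  open CommutativeMonoid M renaming (_∙_ to _+_; ε to 0#; ∙-cong to +-cong; ∙-congˡ to +-congˡ)
  open CommutativeSemigroupProperties commutativeSemigroup using (interchange)
  open import Relation.Binary.Reasoning.Setoid setoid

  Σ< : ℕ → (ℕ → Carrier) → Carrier
  Σ< n f = foldr _+_ 0# (applyUpTo f n)

  when : ∀ {p} {P : Set p} → Dec P → Carrier → Carrier
  when P? x = if does P? then x else 0#

  when-yes : ∀ {p} {P : Set p} (P? : Dec P) {x} → P → when P? x ≈ x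
  when-yes (yes _) _ = refl
  when-yes (no ¬p) p = contradiction p ¬p

  when-no : ∀ {p} {P : Set p} (P? : Dec P) {x} → ¬ P → when P? x ≈ 0#
  when-no (yes p) ¬p = contradiction p ¬p
  when-no (no _) _ = refl

  when-0 : ∀ {p} {P : Set p} (P? : Dec P) {x} → x ≈ 0# → when P? x ≈ 0#
  when-0 (yes _) x≈0 = x≈0
  when-0 (no _) _ = refl

  when-cong : ∀ {p} {P : Set p} (P? : Dec P) {x y} → (P → x ≈ y) → when P? x ≈ when P? y
  when-cong (yes p) x≈y = x≈y p
  when-cong (no _) _ = refl

  when-when-no : ∀ {p q} {P : Set p} {Q : Set q} (P? : Dec P) (Q? : Dec Q) {x} →
                 (P → Q → ⊥) → when P? (when Q? x) ≈ 0#
  when-when-no (yes p) Q? ¬pq = trans (when-yes (yes p) p) (when-no Q? (¬pq p))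
  when-when-no (no _) _ _ = refl

  Σ-filter : ∀ {p} {P : ℕ → Set p} (P? : Decidable P) (h : ℕ → Carrier) (g : ℕ → ℕ) n →
             foldr _+_ 0# (map h (filter P? (applyUpTo g n))) ≈ Σ< n (λ i → when (P? (g i)) (h (g i)))
  Σ-filter P? h g zero = refl
  Σ-filter P? h g (suc n) with does (P? (g 0))
  ... | true = +-congˡ (Σ-filter P? h (λ i → g (suc i)) n)
  ... | false = trans (Σ-filter P? h (λ i → g (suc i)) n) (sym (identityˡ _))

  Σ-cong : ∀ n {f g : ℕ → Carrier} → (∀ i → i < n → f i ≈ g i) → Σ< n f ≈ Σ< n g
  Σ-cong zero f≈g = refl
  Σ-cong (suc n) f≈g = +-cong (f≈g 0 z<s) (Σ-cong n (λ i i<n → f≈g (suc i) (s<s i<n)))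

  Σ-0 : ∀ n {f : ℕ → Carrier} → (∀ i → i < n → f i ≈ 0#) → Σ< n f ≈ 0#
  Σ-0 zero f≈0 = refl
  Σ-0 (suc n) f≈0 = trans (+-cong (f≈0 0 z<s) (Σ-0 n (λ i i<n → f≈0 (suc i) (s<s i<n)))) (identityˡ 0#)

  Σ-+ : ∀ n (f g : ℕ → Carrier) → Σ< n (λ i → f i + g i) ≈ Σ< n f + Σ< n g
  Σ-+ zero f g = sym (identityˡ 0#)
  Σ-+ (suc n) f g = trans (+-congˡ (Σ-+ n (λ i → f (suc i)) (λ i → g (suc i))))
                          (interchange (f 0) (g 0) _ _)

  Σ-swap : ∀ m n (F : ℕ → ℕ → Carrier) → Σ< m (λ i → Σ< n (F i)) ≈ Σ< n (λ j → Σ< m (λ i → F i j))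
  Σ-swap zero n F = sym (Σ-0 n (λ _ _ → refl))
  Σ-swap (suc m) n F = trans (+-congˡ (Σ-swap m n (λ i → F (suc i))))
                             (sym (Σ-+ n (F 0) (λ j → Σ< m (λ i → F (suc i) j))))

  Σ-last : ∀ n (f : ℕ → Carrier) → Σ< (suc n) f ≈ Σ< n f + f n
  Σ-last zero f = trans (identityʳ (f 0)) (sym (identityˡ (f 0)))
  Σ-last (suc n) f = trans (+-congˡ (Σ-last n (λ i → f (suc i)))) (sym (assoc (f 0) _ _))

  Σ-extend : ∀ m n {f : ℕ → Carrier} → m ≤ n → (∀ i → m ≤ i → f i ≈ 0#) → Σ< m f ≈ Σ< n f
  Σ-extend zero n m≤n f≈0 = sym (Σ-0 n (λ i _ → f≈0 i z≤n))
  Σ-extend (suc m) (suc n) (s≤s m≤n) f≈0 = +-congˡ (Σ-extend m n m≤n (λ i m≤i → f≈0 (suc i) (s≤s m≤i)))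

  Σ-single : ∀ {p} {Q : ℕ → Set p} (Q? : Decidable Q) (g : ℕ → Carrier) n i₀ →
             i₀ < n → Q i₀ → (∀ {i} → Q i → i ≡ i₀) → Σ< n (λ i → when (Q? i) (g i)) ≈ g i₀
  Σ-single Q? g (suc n) zero _ q unique = trans
    (+-cong (when-yes (Q? 0) q) (Σ-0 n (λ i _ → when-no (Q? (suc i)) (λ qi → 1+n≢0 (unique qi)))))
    (identityʳ (g 0))
  Σ-single Q? g (suc n) (suc i₀) (s<s i₀<n) q unique = trans
    (+-cong (when-no (Q? 0) (λ q0 → 0≢1+n (unique q0)))
            (Σ-single (λ i → Q? (suc i)) (λ i → g (suc i)) n i₀ i₀<n q (λ qi → suc-injective (unique qi))))
    (identityˡ (g (suc i₀)))

  Σ₁ : ℕ → (ℕ → Carrier) → Carrier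
  Σ₁ n f = Σ< n (λ i → f (suc i))

  Σ-reindex : ∀ {p} {P : ℕ → Set p} (P? : Decidable P) (φ : ℕ → ℕ) (f : ℕ → Carrier) N M →
    (∀ {m m′} → P m → P m′ → φ m ≡ φ m′ → m ≡ m′) →
    (∀ m → 1 ≤ m → m ≤ M → P m → 1 ≤ φ m × φ m ≤ N) →
    (∀ d → 1 ≤ d → d ≤ N → f d ≈ 0# ⊎ ∃[ m ] (1 ≤ m × m ≤ M × P m × φ m ≡ d)) →
    Σ₁ N f ≈ Σ₁ M (λ m → when (P? m) (f (φ m)))
  Σ-reindex {P = P} P? φ f N M injective into covers = begin
    Σ< N (λ i → f (suc i))                                    ≈⟨ Σ-cong N spread ⟩
    Σ< N (λ i → Σ< M (λ j → when (Q? i j) (f (suc i))))      ≈⟨ Σ-swap N M _ ⟩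
    Σ< M (λ j → Σ< N (λ i → when (Q? i j) (f (suc i))))      ≈⟨ Σ-cong M collapse ⟩
    Σ< M (λ j → when (P? (suc j)) (f (φ (suc j))))            ∎
    where
    Q : ℕ → ℕ → Set _
    Q i j = P (suc j) × φ (suc j) ≡ suc i
    Q? : ∀ i j → Dec (Q i j)
    Q? i j = P? (suc j) ×-dec (φ (suc j) ≟ suc i)

    -- each summand f (i + 1) is spread over its (at most one) preimage
    spread : ∀ i → i < N → f (suc i) ≈ Σ< M (λ j → when (Q? i j) (f (suc i)))
    spread i i<N with covers (suc i) (s≤s z≤n) i<N
    ... | inj₁ f≈0 = trans f≈0 (sym (Σ-0 M (λ j _ → when-0 (Q? i j) f≈0)))
    ... | inj₂ (suc j , _ , j<M , pj , φj≡) =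
      sym (Σ-single (λ j → Q? i j) (λ _ → f (suc i)) M j j<M (pj , φj≡)
             (λ (pj′ , φj′≡) → suc-injective (injective pj′ pj (≡.trans φj′≡ (≡.sym φj≡)))))

    collapse : ∀ j → j < M → Σ< N (λ i → when (Q? i j) (f (suc i))) ≈ when (P? (suc j)) (f (φ (suc j)))
    collapse j j<M = by-cases (P? (suc j))
      where
      by-cases : Dec (P (suc j)) → Σ< N (λ i → when (Q? i j) (f (suc i))) ≈ when (P? (suc j)) (f (φ (suc j)))
      by-cases (no ¬pj) = trans (Σ-0 N (λ i _ → when-no (Q? i j) (λ (pj , _) → ¬pj pj)))
                                (sym (when-no (P? (suc j)) ¬pj))
      by-cases (yes pj) = begin
        Σ< N (λ i → when (Q? i j) (f (suc i)))  ≈⟨ Σ-single (λ i → Q? i j) (λ i → f (suc i)) N i₀ i₀<N (pj , φj≡)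
                                                       (λ (_ , φj≡′) → suc-injective (≡.trans (≡.sym φj≡′) φj≡)) ⟩
        f (suc i₀)                              ≡⟨ ≡.cong f (≡.sym φj≡) ⟩
        f (φ (suc j))                           ≈⟨ when-yes (P? (suc j)) pj ⟨
        when (P? (suc j)) (f (φ (suc j)))       ∎
        where
        image : 1 ≤ φ (suc j) × φ (suc j) ≤ N
        image = into (suc j) (s≤s z≤n) j<M pj
        i₀ : ℕ
        i₀ = pred (φ (suc j))
        φj≡ : φ (suc j) ≡ suc i₀
        φj≡ = ≡.sym (suc-pred (φ (suc j)) {{>-nonZero (proj₁ image)}})
        i₀<N : i₀ < N
        i₀<N = ≡.subst (_≤ N) φj≡ (proj₂ image)

  Σ-properDivisors : ∀ (f : ℕ → Carrier) n →
    foldr _+_ 0# (map f (properDivisors n)) ≈ Σ₁ (n ∸ 1) (λ d → when (d ∣? n) (f d))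
  Σ-properDivisors f n = Σ-filter (_∣? n) f suc (n ∸ 1)

  -- For n = q·e: the sum over the proper divisors d of n that are multiples of e, of g (d / e),
  -- is the sum over the proper divisors m of q of g m  (substitute d = m·e).
  Σ-multiples : ∀ (g : ℕ → Carrier) e q n .{{_ : NonZero e}} → n ≡ q * e →
    Σ₁ (n ∸ 1) (λ d → when (d ∣? n) (when (e ∣? d) (g (d / e)))) ≈ Σ₁ (q ∸ 1) (λ m → when (m ∣? q) (g m))
  Σ-multiples g e q n n≡qe = trans
    (Σ-reindex (_∣? q) (_* e) f (n ∸ 1) (q ∸ 1) injective into covers)
    (Σ-cong (q ∸ 1) (λ j _ → when-cong (suc j ∣? q) (at-multiple (suc j))))
    where
    f : ℕ → Carrier
    f d = when (d ∣? n) (when (e ∣? d) (g (d / e)))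

    at-multiple : ∀ m → m ∣ q → f (m * e) ≈ g m
    at-multiple m m∣q = begin
      f (m * e)                                  ≈⟨ when-yes (m * e ∣? n) (≡.subst (m * e ∣_) (≡.sym n≡qe) (*-monoˡ-∣ e m∣q)) ⟩
      when (e ∣? m * e) (g (m * e / e))          ≈⟨ when-yes (e ∣? m * e) (n∣m*n m) ⟩
      g (m * e / e)                              ≡⟨ ≡.cong g (m*n/n≡m m e) ⟩
      g m                                        ∎

    injective : ∀ {m m′} → m ∣ q → m′ ∣ q → m * e ≡ m′ * e → m ≡ m′
    injective _ _ = *-cancelʳ-≡ _ _ e

    into : ∀ m → 1 ≤ m → m ≤ q ∸ 1 → m ∣ q → 1 ≤ m * e × m * e ≤ n ∸ 1
    into m 1≤m m≤q∸1 _ = ≤-trans 1≤m (m≤m*n m e)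
                       , <⇒≤∸1 (≡.subst (m * e <_) (≡.sym n≡qe) (*-monoˡ-< e (≤∸1⇒< {n = q} 1≤m m≤q∸1)))

    covers : ∀ d → 1 ≤ d → d ≤ n ∸ 1 → f d ≈ 0# ⊎ ∃[ m ] (1 ≤ m × m ≤ q ∸ 1 × m ∣ q × m * e ≡ d)
    covers d 1≤d d≤n∸1 = by-cases (d ∣? n) (e ∣? d)
      where
      by-cases : Dec (d ∣ n) → Dec (e ∣ d) → f d ≈ 0# ⊎ ∃[ m ] (1 ≤ m × m ≤ q ∸ 1 × m ∣ q × m * e ≡ d)
      by-cases (no d∤n) _ = inj₁ (when-no (d ∣? n) d∤n)
      by-cases (yes d∣n) (no e∤d) = inj₁ (trans (when-yes (d ∣? n) d∣n) (when-no (e ∣? d) e∤d))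
      by-cases (yes d∣n) (yes (divides zero d≡0)) = contradiction (≡.subst (1 ≤_) d≡0 1≤d) λ ()
      by-cases (yes d∣n) (yes (divides m@(suc _) d≡me)) =
        inj₂ (m , s≤s z≤n , <⇒≤∸1 m<q , *-cancelʳ-∣ e (≡.subst₂ _∣_ d≡me n≡qe d∣n) , ≡.sym d≡me)
        where
        m<q : m < q
        m<q = *-cancelʳ-< _ m q (≡.subst₂ _<_ d≡me n≡qe (≤∸1⇒< 1≤d d≤n∸1))

module NatSums where
  open import Data.Nat using (_+_; _*_)
  open import Data.Nat.Properties
  open import Data.Nat.DivMod using (/-monoˡ-≤; /-monoʳ-≤; n/1≡n; m/n<m; m≥n⇒m/n>0; m*[n/m]≡n)
  open import Function using (_∘_)
  open import Data.Nat.Divisibility using (∣⇒≤)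
  open import Data.Nat.Tactic.RingSolver using (solve-∀)
  open Sums +-0-commutativeMonoid public

  Σ-mono-≤ : ∀ n {f g : ℕ → ℕ} → (∀ i → i < n → f i ≤ g i) → Σ< n f ≤ Σ< n g
  Σ-mono-≤ zero _ = z≤n
  Σ-mono-≤ (suc n) f≤g = +-mono-≤ (f≤g 0 z<s) (Σ-mono-≤ n (λ i i<n → f≤g (suc i) (s<s i<n)))

  when-≤ : ∀ {p} {P : Set p} (P? : Dec P) x → when P? x ≤ x
  when-≤ (yes _) x = ≤-refl
  when-≤ (no _) x = z≤n

  when-mono-≤ : ∀ {p} {P : Set p} (P? : Dec P) {x y} → x ≤ y → when P? x ≤ when P? y
  when-mono-≤ (yes _) x≤y = x≤y
  when-mono-≤ (no _) _ = z≤n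

  telescope : ∀ n (ψ : ℕ → ℕ) → (∀ j → ψ (suc j) ≤ ψ j) → Σ< n (λ j → ψ j ∸ ψ (suc j)) + ψ n ≡ ψ 0
  telescope zero ψ _ = ≡.refl
  telescope (suc n) ψ decreasing = begin-equality
    (ψ 0 ∸ ψ 1 + Σ< n (λ j → ψ (suc j) ∸ ψ (suc (suc j)))) + ψ (suc n)
      ≡⟨ +-assoc (ψ 0 ∸ ψ 1) _ _ ⟩
    ψ 0 ∸ ψ 1 + (Σ< n (λ j → ψ (suc j) ∸ ψ (suc (suc j))) + ψ (suc n))
      ≡⟨ ≡.cong (ψ 0 ∸ ψ 1 +_) (telescope n (λ j → ψ (suc j)) (λ j → decreasing (suc j))) ⟩
    ψ 0 ∸ ψ 1 + ψ 1
      ≡⟨ m∸n+n≡m (decreasing 0) ⟩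
    ψ 0 ∎
    where open ≤-Reasoning

  -- (n / (m+1))² ≤ n²/m − n²/(m+1) when m + 1 divides n: the summands of Σ_k (n/k)² are
  -- dominated by the telescoping differences of n²/k.
  cofactor-square-bound : ∀ m s .{{_ : NonZero m}} →
    let n = suc m * s in s * s ≤ (n * n) / m ∸ (n * n) / suc m
  cofactor-square-bound m s = begin
    s * s                                               ≡⟨ m+n∸n≡m (s * s) (suc m * (s * s)) ⟨
    suc (suc m) * (s * s) ∸ suc m * (s * s)             ≤⟨ ∸-monoˡ-≤ (suc m * (s * s)) lower ⟩
    (n * n) / m ∸ suc m * (s * s)                       ≡⟨ ≡.cong ((n * n) / m ∸_) upper ⟨
    (n * n) / m ∸ (n * n) / suc m                       ∎
    where
    open ≤-Reasoning
    n = suc m * s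
    square-split : n * n ≡ suc (suc m) * (s * s) * m + s * s
    square-split = lemma m s
      where lemma : ∀ m s → (suc m * s) * (suc m * s) ≡ suc (suc m) * (s * s) * m + s * s
            lemma = solve-∀
    square-factor : n * n ≡ suc m * (s * s) * suc m
    square-factor = lemma m s
      where lemma : ∀ m s → (suc m * s) * (suc m * s) ≡ suc m * (s * s) * suc m
            lemma = solve-∀
    upper : (n * n) / suc m ≡ suc m * (s * s)
    upper = ≡.trans (≡.cong (_/ suc m) square-factor) (m*n/n≡m _ (suc m))
    lower : suc (suc m) * (s * s) ≤ (n * n) / m
    lower = begin
      suc (suc m) * (s * s)                         ≡⟨ m*n/n≡m _ m ⟨
      suc (suc m) * (s * s) * m / m                 ≤⟨ /-monoˡ-≤ m (m≤m+n _ (s * s)) ⟩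
      (suc (suc m) * (s * s) * m + s * s) / m       ≡⟨ ≡.cong (_/ m) square-split ⟨
      (n * n) / m                                   ∎

  -- The squares of the proper divisors of n add up to at most n²: writing d = n/k with k ∣ n,
  -- k ≥ 2, each (n/k)² is at most n²/(k−1) − n²/k, and these differences telescope to n² − n²/n.
  proper-divisor-squares : ∀ n → Σ₁ (n ∸ 1) (λ d → when (d ∣? n) (d * d)) ≤ n * n
  proper-divisor-squares zero = z≤n
  proper-divisor-squares n@(suc N) = begin
    Σ₁ N square                                           ≡⟨ Σ-reindex (λ m → suc m ∣? n) cofactor square N N
                                                                       injective into covers ⟩
    Σ₁ N (λ m → when (suc m ∣? n) (square (cofactor m)))  ≤⟨ Σ-mono-≤ N term-bound ⟩
    Σ< N (λ j → ψ j ∸ ψ (suc j))                          ≤⟨ m≤m+n _ (ψ N) ⟩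
    Σ< N (λ j → ψ j ∸ ψ (suc j)) + ψ N                    ≡⟨ telescope N ψ (λ j → /-monoʳ-≤ (n * n) (n≤1+n (suc j))) ⟩
    ψ 0                                                   ≡⟨ n/1≡n (n * n) ⟩
    n * n                                                 ∎
    where
    open ≤-Reasoning
    square : ℕ → ℕ
    square d = when (d ∣? n) (d * d)
    cofactor : ℕ → ℕ
    cofactor m = n / suc m
    ψ : ℕ → ℕ
    ψ j = (n * n) / suc j

    injective : ∀ {m m′} → suc m ∣ n → suc m′ ∣ n → cofactor m ≡ cofactor m′ → m ≡ m′
    injective {m} {m′} m+1∣n m′+1∣n same = suc-injective (*-cancelʳ-≡ (suc m) (suc m′) (cofactor m) {{q≢0}}
      (≡.trans (m*[n/m]≡n m+1∣n) (≡.trans (≡.sym (m*[n/m]≡n m′+1∣n)) (≡.cong (suc m′ *_) (≡.sym same)))))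
      where q≢0 = >-nonZero (m≥n⇒m/n>0 (∣⇒≤ m+1∣n))

    into : ∀ m → 1 ≤ m → m ≤ N → suc m ∣ n → 1 ≤ cofactor m × cofactor m ≤ N
    into m 1≤m _ m+1∣n = m≥n⇒m/n>0 (∣⇒≤ m+1∣n) , ≤-pred (m/n<m n (suc m) (s≤s 1≤m))

    covers : ∀ d → 1 ≤ d → d ≤ N → square d ≡ 0 ⊎ ∃[ m ] (1 ≤ m × m ≤ N × suc m ∣ n × cofactor m ≡ d)
    covers d _ d≤N = by-cases (d ∣? n)
      where
      by-cases : Dec (d ∣ n) → square d ≡ 0 ⊎ ∃[ m ] (1 ≤ m × m ≤ N × suc m ∣ n × cofactor m ≡ d)
      by-cases (no d∤n) = inj₁ (when-no (d ∣? n) d∤n)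
      by-cases (yes (divides zero ()))
      by-cases (yes (divides 1 n≡d)) = contradiction (≡.trans n≡d (+-identityʳ d)) (<⇒≢ (s≤s d≤N) ∘ ≡.sym)
      by-cases (yes (divides k@(suc (suc j)) n≡kd)) =
        inj₂ (suc j , s≤s z≤n , ≤-pred (∣⇒≤ k∣n) , k∣n ,
              ≡.trans (≡.cong (_/ k) (≡.trans n≡kd (*-comm k d))) (m*n/n≡m d k))
        where
        k∣n : k ∣ n
        k∣n = divides d (≡.trans n≡kd (*-comm k d))

    term-bound : ∀ j → j < N → when (suc (suc j) ∣? n) (square (cofactor (suc j))) ≤ ψ j ∸ ψ (suc j)
    term-bound j _ = by-cases (suc (suc j) ∣? n)
      where
      by-cases : Dec (suc (suc j) ∣ n) → when (suc (suc j) ∣? n) (square (cofactor (suc j))) ≤ ψ j ∸ ψ (suc j)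
      by-cases (no k∤n) = ≤-trans (≤-reflexive (when-no (suc (suc j) ∣? n) k∤n)) z≤n
      by-cases (yes k∣n@(divides s n≡sk)) = begin
        when (suc (suc j) ∣? n) (square (cofactor (suc j)))  ≡⟨ when-yes (suc (suc j) ∣? n) k∣n ⟩
        square (cofactor (suc j))                           ≤⟨ when-≤ (cofactor (suc j) ∣? n) _ ⟩
        cofactor (suc j) * cofactor (suc j)                 ≡⟨ ≡.cong (λ t → t * t) cofactor≡s ⟩
        s * s                                               ≤⟨ ≡.subst (λ t → s * s ≤ (t * t) / suc j ∸ (t * t) / suc (suc j))
                                                                       (≡.trans (*-comm (suc (suc j)) s) (≡.sym n≡sk))
                                                                       (cofactor-square-bound (suc j) s) ⟩
        ψ j ∸ ψ (suc j)                                     ∎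
        where
        cofactor≡s : cofactor (suc j) ≡ s
        cofactor≡s = ≡.trans (≡.cong (_/ suc (suc j)) n≡sk) (m*n/n≡m s (suc (suc j)))

module HSequence (H : ℕ → ℕ) (H1 : H 1 ≡ 1) (H-rec : ∀ n → 2 ≤ n → H n ≡ properDivisorSumℕ H n) where
  open import Data.Nat using (_+_; _*_)
  open import Data.Nat.Properties
  open import Data.Nat.Divisibility using (1∣_)
  open import Data.Nat.Induction using (<-rec)
  open NatSums

  H-rec-Σ : ∀ n → 2 ≤ n → H n ≡ Σ₁ (n ∸ 1) (λ d → when (d ∣? n) (H d))
  H-rec-Σ n 2≤n = ≡.trans (H-rec n 2≤n) (Σ-properDivisors H n)

  -- H n ≥ 1: the summand H 1 = 1 always occurs.
  H-positive : ∀ n → 1 ≤ n → 0 < H n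
  H-positive 1 _ = ≤-reflexive (≡.sym H1)
  H-positive n@(suc (suc _)) _ = begin
    1                                        ≡⟨ H1 ⟨
    H 1                                      ≡⟨ when-yes (1 ∣? n) (1∣ n) ⟨
    when (1 ∣? n) (H 1)                      ≤⟨ m≤m+n _ _ ⟩
    Σ₁ (n ∸ 1) (λ d → when (d ∣? n) (H d))   ≡⟨ H-rec-Σ n (s≤s (s≤s z≤n)) ⟨
    H n                                      ∎
    where open ≤-Reasoning

  -- H n ≤ n², by strong induction: H n ≤ Σ_{d ∣ n, d < n} d² ≤ n².
  H-bound : ∀ n → 1 ≤ n → H n ≤ n * n
  H-bound = <-rec (λ n → 1 ≤ n → H n ≤ n * n) step
    where
    step : ∀ n → (∀ {m} → m < n → 1 ≤ m → H m ≤ m * m) → 1 ≤ n → H n ≤ n * n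
    step 1 _ _ = ≤-reflexive H1
    step n@(suc (suc k)) induction _ = begin
      H n                                          ≡⟨ H-rec-Σ n (s≤s (s≤s z≤n)) ⟩
      Σ₁ (suc k) (λ d → when (d ∣? n) (H d))       ≤⟨ Σ-mono-≤ (suc k) (λ i i<k+1 →
                                                        when-mono-≤ (suc i ∣? n) (induction (s≤s i<k+1) (s≤s z≤n))) ⟩
      Σ₁ (suc k) (λ d → when (d ∣? n) (d * d))     ≤⟨ proper-divisor-squares n ⟩
      n * n                                        ∎
      where open ≤-Reasoning

  -- Key identity: for 1 ≤ e < n,  Σ_{d ∣ n, d < n, e ∣ d} H (d / e) = [e ∣ n] H (n / e),
  -- since for n = q·e the left side is Σ_{m ∣ q, m < q} H m = H q.
  H-multiples : ∀ n e .{{_ : NonZero e}} → e < n →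
    Σ₁ (n ∸ 1) (λ d → when (d ∣? n) (when (e ∣? d) (H (d / e)))) ≡ when (e ∣? n) (H (n / e))
  H-multiples n e e<n = by-cases (e ∣? n)
    where
    by-cases : Dec (e ∣ n) → Σ₁ (n ∸ 1) (λ d → when (d ∣? n) (when (e ∣? d) (H (d / e)))) ≡ when (e ∣? n) (H (n / e))
    by-cases (no e∤n) = ≡.trans (Σ-0 (n ∸ 1) (λ i _ → when-when-no (suc i ∣? n) (e ∣? suc i) (λ d∣n e∣d → e∤n (∣-trans e∣d d∣n))))
                                (≡.sym (when-no (e ∣? n) e∤n))
    by-cases (yes e∣n@(divides q n≡qe)) = begin
      Σ₁ (n ∸ 1) (λ d → when (d ∣? n) (when (e ∣? d) (H (d / e))))  ≡⟨ Σ-multiples H e q n n≡qe ⟩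
      Σ₁ (q ∸ 1) (λ m → when (m ∣? q) (H m))                        ≡⟨ H-rec-Σ q 1<q ⟨
      H q                                                           ≡⟨ ≡.cong H (≡.trans (≡.cong (_/ e) n≡qe) (m*n/n≡m q e)) ⟨
      H (n / e)                                                     ≡⟨ when-yes (e ∣? n) e∣n ⟨
      when (e ∣? n) (H (n / e))                                     ∎
      where
      open ≡.≡-Reasoning
      1<q : 1 < q
      1<q = *-cancelʳ-< _ 1 q (≡.subst₂ _<_ (≡.sym (*-identityˡ e)) n≡qe e<n)

module Inversion {c ℓ} (R : CommutativeRing c ℓ)
                 (H : ℕ → ℕ) (H1 : H 1 ≡ 1) (H-rec : ∀ n → 2 ≤ n → H n ≡ properDivisorSumℕ H n) where
  open import Data.Nat.Properties using (<-irrefl; m≤n⇒m≤1+n) renaming (*-identityˡ to ℕ-*-identityˡ)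
  open import Data.Nat.Divisibility using (∣⇒≤; ∣-refl)
  open import Data.Nat.DivMod using (n/n≡1)
  open import Function using (_∘_; id)
  open RingSums R
  open import Algebra.Properties.Monoid.Mult +-monoid using (×-homo-+; ×-homo-1)
  open import Algebra.Properties.AbelianGroup +-abelianGroup using (xyx⁻¹≈y)
  open import Relation.Binary.Reasoning.Setoid setoid
  open Sums +-commutativeMonoid
  open HSequence H H1 H-rec using (H-multiples)
  module ℕΣ = NatSums

  fromℕ-Σ : ∀ n (f : ℕ → ℕ) → fromℕ (ℕΣ.Σ< n f) ≈ Σ< n (fromℕ ∘ f)
  fromℕ-Σ zero f = refl
  fromℕ-Σ (suc n) f = trans (×-homo-+ 1# (f 0) _) (+-congˡ (fromℕ-Σ n (f ∘ suc)))

  *-distribˡ-Σ : ∀ x n (f : ℕ → Carrier) → x * Σ< n f ≈ Σ< n (λ i → x * f i)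
  *-distribˡ-Σ x zero f = zeroʳ x
  *-distribˡ-Σ x (suc n) f = trans (distribˡ x (f 0) _) (+-congˡ (*-distribˡ-Σ x n (f ∘ suc)))

  *-fromℕ-when : ∀ {p} {P : Set p} (P? : Dec P) x k → when P? (x * fromℕ k) ≈ x * fromℕ (ℕΣ.when P? k)
  *-fromℕ-when (yes _) x k = refl
  *-fromℕ-when (no _) x k = sym (zeroʳ x)

  -- The coefficient of b e in a d, for e = k + 1:  [e ∣ d] H (d / e).
  coefficient : ℕ → ℕ → ℕ
  coefficient d k = ℕΣ.when (suc k ∣? d) (H (d / suc k))

  -- The coefficient of b e in Σ_{d ∣ n, d < n} a d, for e = k + 1:  Σ_{d ∣ n, d < n} [e ∣ d] H (d / e).
  proper-coefficient : ℕ → ℕ → ℕ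
  proper-coefficient n k = ℕΣ.Σ₁ (n ∸ 1) (λ d → ℕΣ.when (d ∣? n) (coefficient d k))

  module _ (b : ℕ → Carrier) where

    combination : ℕ → (ℕ → ℕ) → Carrier
    combination N c = Σ< N (λ k → b (suc k) * fromℕ (c k))

    combination-cong : ∀ N {c c′ : ℕ → ℕ} → (∀ k → k < N → c k ≡ c′ k) → combination N c ≈ combination N c′
    combination-cong N c≡c′ = Σ-cong N (λ k k<N → *-congˡ (reflexive (≡.cong fromℕ (c≡c′ k k<N))))

    combination-when : ∀ {p} {P : Set p} (P? : Dec P) N (c : ℕ → ℕ) →
                       when P? (combination N c) ≈ combination N (λ k → ℕΣ.when P? (c k))
    combination-when (yes _) N c = refl
    combination-when (no _) N c = sym (Σ-0 N (λ k _ → zeroʳ (b (suc k))))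

    combination-Σ : ∀ N M (C : ℕ → ℕ → ℕ) →
                    Σ< N (λ i → combination M (C i)) ≈ combination M (λ k → ℕΣ.Σ< N (λ i → C i k))
    combination-Σ N M C = begin
      Σ< N (λ i → Σ< M (λ k → b (suc k) * fromℕ (C i k)))    ≈⟨ Σ-swap N M _ ⟩
      Σ< M (λ k → Σ< N (λ i → b (suc k) * fromℕ (C i k)))    ≈⟨ Σ-cong M (λ k _ → begin
          Σ< N (λ i → b (suc k) * fromℕ (C i k))               ≈⟨ *-distribˡ-Σ (b (suc k)) N _ ⟨
          b (suc k) * Σ< N (λ i → fromℕ (C i k))               ≈⟨ *-congˡ (fromℕ-Σ N (λ i → C i k)) ⟨
          b (suc k) * fromℕ (ℕΣ.Σ< N (λ i → C i k))            ∎) ⟩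
      combination M (λ k → ℕΣ.Σ< N (λ i → C i k))             ∎

    combination-extend : ∀ m n {c : ℕ → ℕ} → m ≤ n → (∀ k → m ≤ k → c k ≡ 0) → combination m c ≈ combination n c
    combination-extend m n m≤n c≡0 = Σ-extend m n m≤n (λ k m≤k → trans (*-congˡ (reflexive (≡.cong fromℕ (c≡0 k m≤k)))) (zeroʳ _))

    combination-last : ∀ N (c : ℕ → ℕ) → combination (suc N) c ≈ combination N c + b (suc N) * fromℕ (c N)
    combination-last N c = Σ-last N (λ k → b (suc k) * fromℕ (c k))

    module _ (a : ℕ → Carrier)
             (a-def : ∀ n → 1 ≤ n → a n ≈ divisorSumWithQuot n (λ d e → b d * fromℕ (H e))) where

      a-expansion : ∀ d → 1 ≤ d → a d ≈ combination d (coefficient d)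
      a-expansion d 1≤d = begin
        a d                                                                  ≈⟨ a-def d 1≤d ⟩
        divisorSumWithQuot d (λ d e → b d * fromℕ (H e))                     ≈⟨ Σ-filter (λ k → suc k ∣? d) (λ k → b (suc k) * fromℕ (H (d / suc k))) id d ⟩
        Σ< d (λ k → when (suc k ∣? d) (b (suc k) * fromℕ (H (d / suc k))))   ≈⟨ Σ-cong d (λ k _ → *-fromℕ-when (suc k ∣? d) (b (suc k)) _) ⟩
        combination d (coefficient d)                                        ∎

      a-expansion-to : ∀ d n → 1 ≤ d → d ≤ n → a d ≈ combination n (coefficient d)
      a-expansion-to d n 1≤d d≤n = trans (a-expansion d 1≤d) (combination-extend d n d≤n (λ k d≤k →
        ℕΣ.when-no (suc k ∣? d) (λ k+1∣d → <-irrefl ≡.refl (≤-trans (∣⇒≤ {{>-nonZero 1≤d}} k+1∣d) d≤k))))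

      proper-sum-expansion : ∀ N → properDivisorSum (suc N) a ≈ combination (suc N) (proper-coefficient (suc N))
      proper-sum-expansion N = begin
        properDivisorSum n a
          ≈⟨ Σ-properDivisors a n ⟩
        Σ< N (λ i → when (suc i ∣? n) (a (suc i)))
          ≈⟨ Σ-cong N (λ i i<N → when-cong (suc i ∣? n) (λ _ → a-expansion-to (suc i) n (s≤s z≤n) (m≤n⇒m≤1+n i<N))) ⟩
        Σ< N (λ i → when (suc i ∣? n) (combination n (coefficient (suc i))))
          ≈⟨ Σ-cong N (λ i _ → combination-when (suc i ∣? n) n (coefficient (suc i))) ⟩
        Σ< N (λ i → combination n (λ k → ℕΣ.when (suc i ∣? n) (coefficient (suc i) k)))
          ≈⟨ combination-Σ N n (λ i k → ℕΣ.when (suc i ∣? n) (coefficient (suc i) k)) ⟩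
        combination n (proper-coefficient n)
          ∎
        where n = suc N

      inversion : ∀ n → 1 ≤ n → b n ≈ a n - properDivisorSum n a
      inversion n@(suc N) _ = begin
        b n                            ≈⟨ xyx⁻¹≈y X (b n) ⟨
        X + b n - X                    ≈⟨ +-cong (sym a-split) (-‿cong (sym proper-split)) ⟩
        a n - properDivisorSum n a     ∎
        where
        X : Carrier
        X = combination N (coefficient n)

        -- the last coefficient of a n is H 1 = 1
        a-split : a n ≈ X + b n
        a-split = begin
          a n                                      ≈⟨ a-expansion n (s≤s z≤n) ⟩
          combination n (coefficient n)            ≈⟨ combination-last N (coefficient n) ⟩
          X + b n * fromℕ (coefficient n N)        ≈⟨ +-congˡ (*-congˡ (reflexive (≡.cong fromℕ last-coefficient))) ⟩
          X + b n * fromℕ 1                        ≈⟨ +-congˡ (trans (*-congˡ (×-homo-1 1#)) (*-identityʳ (b n))) ⟩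
          X + b n                                  ∎
          where
          last-coefficient : coefficient n N ≡ 1
          last-coefficient = ≡.trans (ℕΣ.when-yes (n ∣? n) ∣-refl) (≡.trans (≡.cong H (n/n≡1 n)) H1)

        -- by the key identity the proper divisor sum has the coefficients of a n except the last, which is 0
        proper-split : properDivisorSum n a ≈ X
        proper-split = begin
          properDivisorSum n a                     ≈⟨ proper-sum-expansion N ⟩
          combination n C                          ≈⟨ combination-last N C ⟩
          combination N C + b n * fromℕ (C N)      ≈⟨ +-cong (combination-cong N (λ k k<N → H-multiples n (suc k) (s≤s k<N)))
                                                             (*-congˡ (reflexive (≡.cong fromℕ (ℕΣ.Σ-multiples H n 1 n n≡1*n)))) ⟩
          X + b n * 0#                             ≈⟨ +-congˡ (zeroʳ (b n)) ⟩
          X + 0#                                   ≈⟨ +-identityʳ X ⟩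
          X                                        ∎
          where
          C : ℕ → ℕ
          C = proper-coefficient n
          n≡1*n : n ≡ 1 *ℕ n
          n≡1*n = ≡.sym (ℕ-*-identityˡ n)

lemma2p6 : ∀ {c ℓ : Level} (H : ℕ → ℕ)
    → H 1 ≡ 1
    → (∀ n → 2 ≤ n → H n ≡ properDivisorSumℕ H n)
    → (∀ n → 1 ≤ n → (0 < H n) × (H n ≤ n *ℕ n))
      × ((R : CommutativeRing c ℓ) → let open RingSums R in
           (b a : ℕ → Carrier)
           → (∀ n → 1 ≤ n → a n ≈ divisorSumWithQuot n (λ d e → b d * fromℕ (H e)))
           → ∀ n → 1 ≤ n → b n ≈ a n - properDivisorSum n a)
lemma2p6 H H1 H-rec =
  (λ n 1≤n → H-positive n 1≤n , H-bound n 1≤n) ,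
  (λ R b a a-def → Inversion.inversion R H H1 H-rec b a a-def)
  where open HSequence H H1 H-rec using (H-positive; H-bound)
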